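{- For every $n\ge 1$, $$\sum_{\sigma\in\mathcal{Q}_{n}}x^{\mathrm{asc}(\sigma)}y^{\mathrm{bkone}(\sigma)}q^{\mathrm{bk}(\sigma)}p^{\mathrm{fbk}(\sigma)}=\sum_{\sigma\in\widehat{\mathcal{Q}}_{n}}x^{\mathrm{exc}(\sigma)}y^{\mathrm{fix}(\sigma)}q^{\mathrm{cyc}(\sigma)}p^{\mathrm{fcyc}(\sigma)}.$$
   Context: Permutations $\sigma$ of $[n]$ are written as words $\sigma_1\cdots\sigma_n$; $\mathrm{asc}(\sigma)$ is the number of $i\in[n-1]$ with $\sigma_i<\sigma_{i+1}$. $\mathcal{Q}_n$ is the set of permutations $\sigma$ of $[n]$ with $\sigma_1<\sigma_2<\cdots<\sigma_p$ where $\sigma_p=n$ (the identity included). An entry $\sigma_i$ is a right-to-left maximum if $i=n$ or $\sigma_i>\sigma_j$ for all $j>i$. If the right-to-left maxima occur at positions $i_1<i_2<\cdots<i_r$ (so $i_r=n$), the blocks of $\sigma$ are the factors $\sigma_1\cdots\sigma_{i_1}$, $\sigma_{i_1+1}\cdots\sigma_{i_2}$, …, $\sigma_{i_{r-1}+1}\cdots\sigma_{i_r}$; $\mathrm{bk}(\sigma)=r$, $\mathrm{bkone}(\sigma)$ is the number of blocks of length one, and $\mathrm{fbk}(\sigma)=i_1$ is the length of the first block. For $\sigma\in\mathfrak{S}_n$: $\mathrm{exc}(\sigma)=|\{i:\sigma(i)>i\}|$, $\mathrm{fix}(\sigma)=|\{i:\sigma(i)=i\}|$, $\mathrm{cyc}(\sigma)$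 is the number of cycles. The standard cycle form writes each cycle ending with its largest element and lists cycles in decreasing order of their largest elements. $\widehat{\mathcal{Q}}_n$ is the set of $\sigma\in\mathfrak{S}_n$ whose cycle containing $n$, written as $(c_1,\dots,c_k,n)$ ending with $n$, satisfies $c_1<c_2<\cdots<c_k$; $\mathrm{fcyc}(\sigma)$ is the number of elements of the cycle containing $n$. -}

module Defs where

open import Level using (Level)
open import Data.Bool using (Bool; true; false; _∧_; if_then_else_)
open import Data.Nat using (ℕ; zero; suc; _∸_; _<ᵇ_; _≤ᵇ_; _≡ᵇ_)
open import Data.List using (List; []; _∷_; map; concatMap; filterᵇ; length; upTo; foldr)
open import Data.Bool.ListAction using (all; any)
open import Algebra.Bundles using (CommutativeSemiring)

-- Permutations of [n] are represented as words σ₁⋯σₙ : List ℕ with entries in {1,…,n}.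

range : ℕ → List ℕ
range n = map suc (upTo n)

-- σ_i (1-indexed); 0 outside of the range
nth : List ℕ → ℕ → ℕ
nth []      _             = 0
nth (a ∷ w) zero          = 0
nth (a ∷ w) (suc zero)    = a
nth (a ∷ w) (suc (suc i)) = nth w (suc i)

count : {A : Set} → (A → Bool) → List A → ℕ
count p xs = length (filterᵇ p xs)

words : ℕ → ℕ → List (List ℕ)
words zero    n = [] ∷ []
words (suc k) n = concatMap (λ a → map (a ∷_) (words k n)) (range n)

-- a word of length n over [n] is a permutation iff every j ∈ [n] occurs in it
isPerm : ℕ → List ℕ → Bool
isPerm n w = all (λ j → any (λ a → a ≡ᵇ j) w) (range n)

perms : ℕ → List (List ℕ)
perms n = filterᵇ (isPerm n) (words n n)

asc : List ℕ → ℕ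
asc w = count (λ i → nth w i <ᵇ nth w (suc i)) (range (length w ∸ 1))

-- position of the value v in w (1-indexed; 0 if absent)
posOf : List ℕ → ℕ → ℕ
posOf []      v = 0
posOf (a ∷ w) v = if a ≡ᵇ v then 1 else suc (posOf w v)

isQ : ℕ → List ℕ → Bool
isQ n w = all (λ i → nth w i <ᵇ nth w (suc i)) (range (posOf w n ∸ 1))

isRLmax : List ℕ → ℕ → Bool
isRLmax w i = all (λ j → (i <ᵇ j) ⇒ᵇ (nth w j <ᵇ nth w i)) (range (length w))
  where
  _⇒ᵇ_ : Bool → Bool → Bool
  true  ⇒ᵇ b = b
  false ⇒ᵇ b = true

rlPos : List ℕ → List ℕ
rlPos w = filterᵇ (isRLmax w) (range (length w))

bk : List ℕ → ℕ
bk w = length (rlPos w)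

fbk : List ℕ → ℕ
fbk w with rlPos w
... | []    = 0
... | i ∷ _ = i

-- number of blocks of length one, given previous block end `prev`
oneGaps : ℕ → List ℕ → ℕ
oneGaps prev []       = 0
oneGaps prev (i ∷ is) = (if (i ∸ prev) ≡ᵇ 1 then 1 else 0) Data.Nat.+ oneGaps i is

bkone : List ℕ → ℕ
bkone w = oneGaps 0 (rlPos w)

-- Permutation (function / cycle) statistics, σ(i) = σ_i

exc : List ℕ → ℕ
exc w = count (λ i → i <ᵇ nth w i) (range (length w))

fix : List ℕ → ℕ
fix w = count (λ i → nth w i ≡ᵇ i) (range (length w))

iter : List ℕ → ℕ → ℕ → ℕ
iter w zero    i = i
iter w (suc k) i = nth w (iter w k i)

-- number of cycles = number of i ∈ [n] that are the largest element of their cycle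
cyc : List ℕ → ℕ
cyc w = count (λ i → all (λ k → iter w k i ≤ᵇ i) (upTo (length w))) (range (length w))

fcyc : List ℕ → ℕ
fcyc w = count (λ j → any (λ k → iter w k n ≡ᵇ j) (upTo n)) (range n)
  where n = length w

-- 𝒬̂ₙ membership: cycle of n is (c₁,…,c_k,n) with cₘ = σ^m(n), requiring c₁ < ⋯ < c_k
isQhat : ℕ → List ℕ → Bool
isQhat n w = all (λ m → iter w m n <ᵇ iter w (suc m) n) (range (fcyc w ∸ 2))

module _ {c ℓ : Level} (R : CommutativeSemiring c ℓ) where
  open CommutativeSemiring R

  pow : Carrier → ℕ → Carrier
  pow x zero    = 1#
  pow x (suc k) = x * pow x k

  sumOver : {A : Set} → List A → (A → Carrier) → Carrier
  sumOver xs f = foldr (λ a s → f a + s) 0# xs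

lhsQ : {c ℓ : Level} (R : CommutativeSemiring c ℓ) → (x y q p : CommutativeSemiring.Carrier R) → ℕ → CommutativeSemiring.Carrier R
lhsQ R x y q p n = sumOver R (filterᵇ (isQ n) (perms n))
  (λ σ → pow R x (asc σ) * pow R y (bkone σ) * pow R q (bk σ) * pow R p (fbk σ))
  where open CommutativeSemiring R

rhsQhat : {c ℓ : Level} (R : CommutativeSemiring c ℓ) → (x y q p : CommutativeSemiring.Carrier R) → ℕ → CommutativeSemiring.Carrier R
rhsQhat R x y q p n = sumOver R (filterᵇ (isQhat n) (perms n))
  (λ σ → pow R x (exc σ) * pow R y (fix σ) * pow R q (cyc σ) * pow R p (fcyc σ))
  where open CommutativeSemiring R

-- Cut w = σ₁⋯σₙ after each right-to-left maximum and let Φ w be the permutation whose cycles are the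
-- blocks: Φ w maps each entry to the next entry of its block and the last entry of a block (its maximum)
-- to the first. Ascents of w become excedances, blocks become cycles, blocks of length one become fixed
-- points, and the first block, which ends with n, becomes the cycle of n; so 𝒬ₙ is sent onto 𝒬̂ₙ with all
-- four statistics matched. Φ is a bijection of 𝔖ₙ since w is recovered from Φ w from left to right:
-- w₁ = Φ w (n), within a block the next entry is the image of the current one, and a new block ends at the
-- greatest cycle maximum of Φ w below the maximum of the previous block.
module Submission where

open import Level using (Level)
open import Algebra.Bundles using (CommutativeSemiring)
open import Data.Bool using (Bool; true; false; if_then_else_; _∧_)
open import Data.Bool.Properties using (T-≡; T?; ∧-assoc; ∧-identityʳ)
open import Data.Bool.ListAction using (all; any)
open import Data.List using (List; []; _∷_; [_]; _++_; map; concatMap; cartesianProductWith; filterᵇ; length; upTo; applyUpTo; foldr)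
open import Data.List.Properties
  using (map-applyUpTo; length-map; length-upTo; upTo-∷ʳ; map-++; foldr-map; ∷-injective; filter-++; length-++; map-cong-local)
open import Data.List.Membership.Propositional using (_∈_)
open import Data.List.Membership.Propositional.Properties
  using (∈-map⁺; ∈-map⁻; ∈-upTo⁺; ∈-upTo⁻; ∈-∃++; ∈-filter⁺; ∈-filter⁻; ∈-cartesianProductWith⁺; ∈-cartesianProductWith⁻)
open import Data.List.Relation.Binary.Subset.Propositional using (_⊆_)
open import Data.List.Relation.Binary.Permutation.Propositional
  using (_↭_; ↭-refl; ↭-sym; ↭-trans; ↭-prep; ↭-reflexive; ↭⇒↭ₛ; ↭⇒↭ₛ′)
open import Data.List.Relation.Binary.Permutation.Propositional.Properties using (↭-length; shift; ∈-resp-↭; filter-↭; map⁺)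
import Data.List.Relation.Binary.Permutation.Setoid.Properties as SetoidPermutation
import Data.List.Relation.Unary.All as All
open import Data.List.Relation.Unary.AllPairs using ([]; _∷_)
open import Data.List.Relation.Unary.Any using (here; there)
open import Data.List.Relation.Unary.Unique.Propositional using (Unique)
open import Data.List.Relation.Unary.Unique.Propositional.Properties as Unique using (upTo⁺; cartesianProductWith⁺)
open import Data.Nat using (ℕ; zero; suc; _+_; _∸_; _⊓_; _≤_; _<_; _<ᵇ_; _≤ᵇ_; _≡ᵇ_; z≤n; s≤s)
open import Data.Nat.Properties
  using (+-comm; +-identityʳ; +-monoʳ-≤; +-suc; 1+n≢n; <-asym; <-cmp; <-irrefl; <-trans; <-≤-trans; <⇒≤; <⇒≱; ≤-antisym;
         ≤-pred; ≤-refl; ≤-reflexive; ≤-trans; ≤⇒≯; ≤∧≢⇒<; ≮⇒≥; ≰⇒>; n≤1+n; suc-injective; m≤m+n; m≤n⇒m≤1+n;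
         m≤n⇒m<n∨m≡n; m+[n∸m]≡n; m<n⇒0<n∸m; ∸-monoʳ-<; ∸-monoˡ-≤; m≤n⇒m⊓n≡m; m≥n⇒m⊓n≡n; ⊓-zeroʳ;
         <ᵇ-reflects-<; ≤ᵇ-reflects-≤; ≡ᵇ⇒≡; ≡⇒≡ᵇ)
open import Data.Product using (∃; _×_; _,_; proj₁; proj₂)
open import Data.Sum using (_⊎_; inj₁; inj₂)
open import Function.Base using (_∘_; id; case_of_)
open import Function.Bundles using (Equivalence)
open import Relation.Binary.Definitions using (tri<; tri≈; tri>)
open import Relation.Binary.PropositionalEquality using (_≡_; refl; sym; trans; cong; cong₂; subst; subst₂; module ≡-Reasoning)
  renaming (setoid to ≡-setoid)
open import Relation.Nullary using (¬_; contradiction)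
open import Relation.Nullary.Reflects using (Reflects; ofʸ; ofⁿ; fromEquivalence)

open import Defs

module _ {p} {P : Set p} where

  invertʸ : ∀ {b} → Reflects P b → b ≡ true → P
  invertʸ (ofʸ x) refl = x

  invertⁿ : ∀ {b} → Reflects P b → b ≡ false → ¬ P
  invertⁿ (ofⁿ ¬x) refl = ¬x

  reflectʸ : ∀ {b} → Reflects P b → P → b ≡ true
  reflectʸ (ofʸ _) _ = refl
  reflectʸ (ofⁿ ¬x) x = contradiction x ¬x

  reflectⁿ : ∀ {b} → Reflects P b → ¬ P → b ≡ false
  reflectⁿ (ofʸ x) ¬x = contradiction x ¬x
  reflectⁿ (ofⁿ _) _ = refl

≡ᵇ-reflects-≡ : ∀ m n → Reflects (m ≡ n) (m ≡ᵇ n)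
≡ᵇ-reflects-≡ m n = fromEquivalence (≡ᵇ⇒≡ m n) (≡⇒≡ᵇ m n)

reflects-≡ : ∀ {p q} {P : Set p} {Q : Set q} {a b : Bool} → Reflects P a → Reflects Q b → (P → Q) → (Q → P) → a ≡ b
reflects-≡ (ofʸ _) (ofʸ _) _ _ = refl
reflects-≡ (ofʸ x) (ofⁿ ¬y) P→Q _ = contradiction (P→Q x) ¬y
reflects-≡ (ofⁿ ¬x) (ofʸ y) _ Q→P = contradiction (Q→P y) ¬x
reflects-≡ (ofⁿ _) (ofⁿ _) _ _ = refl

Bool-ext : ∀ {a b : Bool} → (a ≡ true → b ≡ true) → (b ≡ true → a ≡ true) → a ≡ b
Bool-ext {true} {true} _ _ = refl
Bool-ext {true} {false} a⇒b _ = sym (a⇒b refl)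
Bool-ext {false} {true} _ b⇒a = b⇒a refl
Bool-ext {false} {false} _ _ = refl

module _ {A : Set} where

  unique∧⊆∧length⇒↭ : {xs ys : List A} → Unique xs → xs ⊆ ys → length ys ≤ length xs → xs ↭ ys
  unique∧⊆∧length⇒↭ {[]} {[]} _ _ _ = ↭-refl
  unique∧⊆∧length⇒↭ {x ∷ xs} (x≢xs ∷ xs-unique) xs⊆ys len with ∈-∃++ (xs⊆ys (here refl))
  ... | us , vs , refl = ↭-trans (↭-prep x (unique∧⊆∧length⇒↭ xs-unique xs⊆us++vs len′)) (↭-sym (shift x us vs))
    where
    xs⊆us++vs : xs ⊆ us ++ vs
    xs⊆us++vs y∈xs with ∈-resp-↭ (shift x us vs) (xs⊆ys (there y∈xs))
    ... | here y≡x = contradiction (sym y≡x) (All.lookup x≢xs y∈xs)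
    ... | there y∈us++vs = y∈us++vs
    len′ : length (us ++ vs) ≤ length xs
    len′ = ≤-pred (subst (_≤ suc (length xs)) (↭-length (shift x us vs)) len)

  unique-map-injectiveOn : {B : Set} (f : A → B) {xs : List A} →
    (∀ {x y} → x ∈ xs → y ∈ xs → f x ≡ f y → x ≡ y) → Unique xs → Unique (map f xs)
  unique-map-injectiveOn f inj [] = []
  unique-map-injectiveOn f {x ∷ xs} inj (x≢xs ∷ xs-unique) =
    All.tabulate (λ fy∈ fx≡fy → let (y , y∈xs , fy≡) = ∈-map⁻ f fy∈ in
      All.lookup x≢xs y∈xs (inj (here refl) (there y∈xs) (trans fx≡fy fy≡)))
    ∷ unique-map-injectiveOn f (λ x∈ y∈ → inj (there x∈) (there y∈)) xs-unique

module _ {A : Set} (p : A → Bool) where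

  all-true⁺ : (xs : List A) → (∀ {x} → x ∈ xs → p x ≡ true) → all p xs ≡ true
  all-true⁺ [] _ = refl
  all-true⁺ (x ∷ xs) px rewrite px (here refl) = all-true⁺ xs (px ∘ there)

  all-true⁻ : (xs : List A) → all p xs ≡ true → ∀ {x} → x ∈ xs → p x ≡ true
  all-true⁻ (x ∷ xs) all≡ x∈ with p x in px
  all-true⁻ (x ∷ xs) all≡ (here refl) | true = px
  all-true⁻ (x ∷ xs) all≡ (there x∈) | true = all-true⁻ xs all≡ x∈

  all-false⁺ : (xs : List A) {x : A} → x ∈ xs → p x ≡ false → all p xs ≡ false
  all-false⁺ (x ∷ xs) (here refl) px rewrite px = refl
  all-false⁺ (x ∷ xs) (there x∈) px with p x
  ... | true = all-false⁺ xs x∈ px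
  ... | false = refl

  all-false⁻ : (xs : List A) → all p xs ≡ false → ∃ λ x → x ∈ xs × p x ≡ false
  all-false⁻ (x ∷ xs) all≡ with p x in px
  ... | false = x , here refl , px
  ... | true = let (y , y∈ , py) = all-false⁻ xs all≡ in y , there y∈ , py

  any-true⁺ : (xs : List A) {x : A} → x ∈ xs → p x ≡ true → any p xs ≡ true
  any-true⁺ (x ∷ xs) (here refl) px rewrite px = refl
  any-true⁺ (x ∷ xs) (there x∈) px with p x
  ... | true = refl
  ... | false = any-true⁺ xs x∈ px

  any-true⁻ : (xs : List A) → any p xs ≡ true → ∃ λ x → x ∈ xs × p x ≡ true
  any-true⁻ (x ∷ xs) any≡ with p x in px
  ... | true = x , here refl , px
  ... | false = let (y , y∈ , py) = any-true⁻ xs any≡ in y , there y∈ , py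

  all-++ : (xs ys : List A) → all p (xs ++ ys) ≡ all p xs ∧ all p ys
  all-++ [] ys = refl
  all-++ (x ∷ xs) ys rewrite all-++ xs ys = sym (∧-assoc (p x) _ _)

  filterᵇ-accept : ∀ {x} xs → p x ≡ true → filterᵇ p (x ∷ xs) ≡ x ∷ filterᵇ p xs
  filterᵇ-accept {x} xs px with p x
  filterᵇ-accept xs refl | true = refl

  filterᵇ-reject : ∀ {x} xs → p x ≡ false → filterᵇ p (x ∷ xs) ≡ filterᵇ p xs
  filterᵇ-reject {x} xs px with p x
  filterᵇ-reject xs refl | false = refl

  count-∷ : ∀ x xs → count p (x ∷ xs) ≡ (if p x then 1 else 0) + count p xs
  count-∷ x xs with p x
  ... | true = refl
  ... | false = refl

  count-++ : (xs ys : List A) → count p (xs ++ ys) ≡ count p xs + count p ys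
  count-++ xs ys = trans (cong length (filter-++ (T? ∘ p) xs ys)) (length-++ (filterᵇ p xs))

  count-↭ : {xs ys : List A} → xs ↭ ys → count p xs ≡ count p ys
  count-↭ xs↭ys = ↭-length (filter-↭ (T? ∘ p) xs↭ys)

  count-map : {B : Set} (f : B → A) (xs : List B) → count p (map f xs) ≡ count (p ∘ f) xs
  count-map f [] = refl
  count-map f (x ∷ xs) with p (f x)
  ... | true = cong suc (count-map f xs)
  ... | false = count-map f xs

module _ {A : Set} where

  all-cong-∈ : {p q : A → Bool} (xs : List A) → (∀ {x} → x ∈ xs → p x ≡ q x) → all p xs ≡ all q xs
  all-cong-∈ [] _ = refl
  all-cong-∈ (x ∷ xs) p≡q = cong₂ _∧_ (p≡q (here refl)) (all-cong-∈ xs (p≡q ∘ there))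

  count-cong-∈ : {p q : A → Bool} (xs : List A) → (∀ {x} → x ∈ xs → p x ≡ q x) → count p xs ≡ count q xs
  count-cong-∈ {p} {q} [] _ = refl
  count-cong-∈ {p} {q} (x ∷ xs) p≡q with p x | q x | p≡q (here refl)
  ... | true | .true | refl = cong suc (count-cong-∈ xs (p≡q ∘ there))
  ... | false | .false | refl = count-cong-∈ xs (p≡q ∘ there)

module _ {c ℓ : Level} (R : CommutativeSemiring c ℓ) where
  open CommutativeSemiring R
    using (Carrier; _≈_; 0#; +-cong; +-congˡ; +-identityˡ; +-isCommutativeMonoid; setoid)
    renaming (_+_ to _⊕_; isEquivalence to ≈-isEquivalence; refl to ≈-refl; sym to ≈-sym; trans to ≈-trans)

  sumOver-filter : {A : Set} (p : A → Bool) (xs : List A) (f : A → Carrier) →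
    sumOver R (filterᵇ p xs) f ≈ sumOver R xs (λ a → if p a then f a else 0#)
  sumOver-filter p [] f = ≈-refl
  sumOver-filter p (x ∷ xs) f with p x
  ... | true = +-congˡ (sumOver-filter p xs f)
  ... | false = ≈-trans (sumOver-filter p xs f) (≈-sym (+-identityˡ _))

  sumOver-cong-∈ : {A : Set} (xs : List A) {f g : A → Carrier} → (∀ {a} → a ∈ xs → f a ≈ g a) →
    sumOver R xs f ≈ sumOver R xs g
  sumOver-cong-∈ [] _ = ≈-refl
  sumOver-cong-∈ (x ∷ xs) f≈g = +-cong (f≈g (here refl)) (sumOver-cong-∈ xs (f≈g ∘ there))

  sumOver-map : {A B : Set} (h : A → B) (xs : List A) (f : B → Carrier) → sumOver R (map h xs) f ≡ sumOver R xs (f ∘ h)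
  sumOver-map h xs f = foldr-map (λ b s → f b ⊕ s) h 0# xs

  sumOver-↭ : {A : Set} {xs ys : List A} → xs ↭ ys → (f : A → Carrier) → sumOver R xs f ≈ sumOver R ys f
  sumOver-↭ {xs = xs} {ys} xs↭ys f = begin
    sumOver R xs f ≡⟨ foldr-map _⊕_ f 0# xs ⟨
    foldr _⊕_ 0# (map f xs) ≈⟨ foldr-commMonoid +-isCommutativeMonoid (↭⇒↭ₛ′ ≈-isEquivalence (map⁺ f xs↭ys)) ⟩
    foldr _⊕_ 0# (map f ys) ≡⟨ foldr-map _⊕_ f 0# ys ⟩
    sumOver R ys f ∎
    where
    open SetoidPermutation setoid using (foldr-commMonoid)
    open import Relation.Binary.Reasoning.Setoid setoid

infix 4 1≤_≤_
1≤_≤_ : ℕ → ℕ → Set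
1≤ j ≤ n = 1 ≤ j × j ≤ n

∈-range⁺ : ∀ {n j} → 1≤ j ≤ n → j ∈ range n
∈-range⁺ {j = suc i} (_ , i<n) = ∈-map⁺ suc (∈-upTo⁺ i<n)

∈-range⁻ : ∀ {n j} → j ∈ range n → 1≤ j ≤ n
∈-range⁻ j∈ with ∈-map⁻ suc j∈
... | i , i∈ , refl = s≤s z≤n , ∈-upTo⁻ i∈

length-range : ∀ n → length (range n) ≡ n
length-range n = trans (length-map suc (upTo n)) (length-upTo n)

unique-range : ∀ n → Unique (range n)
unique-range n = Unique.map⁺ suc-injective (upTo⁺ n)

range-suc : ∀ n → range (suc n) ≡ range n ++ [ suc n ]
range-suc n = trans (cong (map suc) (sym (upTo-∷ʳ n))) (map-++ suc (upTo n) [ n ])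

interval : ℕ → ℕ → List ℕ
interval a zero = []
interval a (suc d) = a ∷ interval (suc a) d

range-interval : ∀ n → range n ≡ interval 1 n
range-interval n = trans (map-applyUpTo id suc n) (applyUpTo-interval suc 1 n λ _ → refl)
  where
  applyUpTo-interval : ∀ (f : ℕ → ℕ) a d → (∀ i → f i ≡ a + i) → applyUpTo f d ≡ interval a d
  applyUpTo-interval f a zero _ = refl
  applyUpTo-interval f a (suc d) f≗a+ = cong₂ _∷_ (trans (f≗a+ 0) (+-identityʳ a))
    (applyUpTo-interval (f ∘ suc) (suc a) d λ i → trans (f≗a+ (suc i)) (+-suc a i))

filterᵇ-interval-first : ∀ (P : ℕ → Bool) a d {e} → a ≤ e → e < a + d → P e ≡ true →
  (∀ {p} → a ≤ p → p < e → P p ≡ false) → ∃ λ rest → filterᵇ P (interval a d) ≡ e ∷ rest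
filterᵇ-interval-first P a zero a≤e e< _ _ = contradiction (subst (_≤ _) (sym (+-identityʳ a)) a≤e) (<⇒≱ e<)
filterᵇ-interval-first P a (suc d) {e} a≤e e< Pe none with m≤n⇒m<n∨m≡n a≤e
... | inj₂ refl = _ , filterᵇ-accept P (interval (suc a) d) Pe
... | inj₁ a<e =
  let (rest , ≡e∷rest) = filterᵇ-interval-first P (suc a) d a<e (subst (e <_) (+-suc a d) e<) Pe (none ∘ <⇒≤) in
  rest , trans (filterᵇ-reject P (interval (suc a) d) (none ≤-refl a<e)) ≡e∷rest

count-≤ᵇ-range : ∀ i n → count (_≤ᵇ i) (range n) ≡ i ⊓ n
count-≤ᵇ-range i zero = sym (⊓-zeroʳ i)
count-≤ᵇ-range i (suc n) = begin
  count (_≤ᵇ i) (range (suc n)) ≡⟨ cong (count (_≤ᵇ i)) (range-suc n) ⟩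
  count (_≤ᵇ i) (range n ++ [ suc n ]) ≡⟨ count-++ (_≤ᵇ i) (range n) [ suc n ] ⟩
  count (_≤ᵇ i) (range n) + count (_≤ᵇ i) [ suc n ] ≡⟨ cong (_+ count (_≤ᵇ i) [ suc n ]) (count-≤ᵇ-range i n) ⟩
  i ⊓ n + count (_≤ᵇ i) [ suc n ] ≡⟨ last-step ⟩
  i ⊓ suc n ∎
  where
  open ≡-Reasoning
  last-step : i ⊓ n + count (_≤ᵇ i) [ suc n ] ≡ i ⊓ suc n
  last-step with suc n ≤ᵇ i in n<ᵇi
  ... | true = let n<i = invertʸ (≤ᵇ-reflects-≤ (suc n) i) n<ᵇi in
    trans (cong (_+ 1) (m≥n⇒m⊓n≡n (<⇒≤ n<i))) (trans (+-comm n 1) (sym (m≥n⇒m⊓n≡n n<i)))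
  ... | false = let i≤n = ≤-pred (≰⇒> (invertⁿ (≤ᵇ-reflects-≤ (suc n) i) n<ᵇi)) in
    trans (+-identityʳ _) (trans (m≤n⇒m⊓n≡m i≤n) (sym (m≤n⇒m⊓n≡m (m≤n⇒m≤1+n i≤n))))

concatMap≡cartesianProductWith : {A : Set} (W : List (List A)) (as : List A) →
  concatMap (λ a → map (a ∷_) W) as ≡ cartesianProductWith _∷_ as W
concatMap≡cartesianProductWith W [] = refl
concatMap≡cartesianProductWith W (a ∷ as) = cong (map (a ∷_) W ++_) (concatMap≡cartesianProductWith W as)

∈-words⁺ : ∀ k n {w} → length w ≡ k → w ⊆ range n → w ∈ words k n
∈-words⁺ zero n {[]} _ _ = here refl
∈-words⁺ (suc k) n {a ∷ w} len w⊆ =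
  subst ((a ∷ w) ∈_) (sym (concatMap≡cartesianProductWith (words k n) (range n)))
    (∈-cartesianProductWith⁺ _∷_ (w⊆ (here refl)) (∈-words⁺ k n (suc-injective len) (w⊆ ∘ there)))

∈-words⁻ : ∀ k n {w} → w ∈ words k n → length w ≡ k × w ⊆ range n
∈-words⁻ zero n (here refl) = refl , λ ()
∈-words⁻ (suc k) n w∈
  with a , v , a∈ , v∈ , refl ← ∈-cartesianProductWith⁻ _∷_ (range n) (words k n)
         (subst (_ ∈_) (concatMap≡cartesianProductWith (words k n) (range n)) w∈)
  = let (len , v⊆) = ∈-words⁻ k n v∈ in cong suc len , λ { (here refl) → a∈ ; (there x∈) → v⊆ x∈ }

unique-words : ∀ k n → Unique (words k n)
unique-words zero n = All.[] ∷ []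
unique-words (suc k) n = subst Unique (sym (concatMap≡cartesianProductWith (words k n) (range n)))
  (cartesianProductWith⁺ _∷_ ∷-injective (unique-range n) (unique-words k n))

unique-perms : ∀ n → Unique (perms n)
unique-perms n = Unique.filter⁺ (T? ∘ isPerm n) (unique-words n n)

∈-perms⁻ : ∀ n {w} → w ∈ perms n → range n ↭ w
∈-perms⁻ n {w} w∈ =
  let (w∈words , isPerm≡) = ∈-filter⁻ (T? ∘ isPerm n) w∈
      (len , _) = ∈-words⁻ n n w∈words
      range⊆w : range n ⊆ w
      range⊆w j∈ = let (a , a∈ , a≡j) = any-true⁻ _ w (all-true⁻ _ (range n) (Equivalence.to T-≡ isPerm≡) j∈)
                   in subst (_∈ w) (invertʸ (≡ᵇ-reflects-≡ a _) a≡j) a∈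
  in unique∧⊆∧length⇒↭ (unique-range n) range⊆w (≤-reflexive (trans len (sym (length-range n))))

∈-perms⁺ : ∀ n {w} → range n ↭ w → w ∈ perms n
∈-perms⁺ n {w} range↭w = ∈-filter⁺ (T? ∘ isPerm n)
  (∈-words⁺ n n (trans (sym (↭-length range↭w)) (length-range n)) (∈-resp-↭ (↭-sym range↭w)))
  (Equivalence.from T-≡ (all-true⁺ _ (range n) λ {j} j∈ →
    any-true⁺ _ w (∈-resp-↭ range↭w j∈) (reflectʸ (≡ᵇ-reflects-≡ j j) refl)))

nth-map-interval : ∀ (f : ℕ → ℕ) a d i → i < d → nth (map f (interval a d)) (suc i) ≡ f (a + i)
nth-map-interval f a (suc d) zero _ = cong f (sym (+-identityʳ a))
nth-map-interval f a (suc d) (suc i) i<d = trans (nth-map-interval f (suc a) d i (≤-pred i<d)) (cong f (sym (+-suc a i)))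

nth-map-range : ∀ (f : ℕ → ℕ) n {v} → 1≤ v ≤ n → nth (map f (range n)) v ≡ f v
nth-map-range f n {suc i} (_ , i<n) rewrite range-interval n = nth-map-interval f 1 n i i<n

map-nth-range : ∀ w → map (nth w) (range (length w)) ≡ w
map-nth-range w = trans (cong (map (nth w)) (range-interval (length w))) (map-nth-interval w)
  where
  drop-head : ∀ x w a l → map (nth (x ∷ w)) (interval (suc (suc a)) l) ≡ map (nth w) (interval (suc a) l)
  drop-head x w a zero = refl
  drop-head x w a (suc l) = cong (nth w (suc a) ∷_) (drop-head x w (suc a) l)
  map-nth-interval : ∀ w → map (nth w) (interval 1 (length w)) ≡ w
  map-nth-interval [] = refl
  map-nth-interval (x ∷ w) = cong (x ∷_) (trans (drop-head x w 0 (length w)) (map-nth-interval w))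

nth-∈ : ∀ w {j} → 1≤ j ≤ length w → nth w j ∈ w
nth-∈ w j-pos = subst (nth w _ ∈_) (map-nth-range w) (∈-map⁺ (nth w) (∈-range⁺ j-pos))

nth-beyond : ∀ w j → length w < j → nth w j ≡ 0
nth-beyond [] j _ = refl
nth-beyond (x ∷ w) (suc (suc j)) (s≤s len<j) = nth-beyond w (suc j) len<j

nth-ext : ∀ w v → length w ≡ length v → (∀ {j} → 1≤ j ≤ length w → nth w j ≡ nth v j) → w ≡ v
nth-ext w v len≡ nth≡ = begin
  w                                  ≡⟨ map-nth-range w ⟨
  map (nth w) (range (length w))     ≡⟨ map-cong-local (All.tabulate (nth≡ ∘ ∈-range⁻)) ⟩
  map (nth v) (range (length w))     ≡⟨ cong (λ n → map (nth v) (range n)) len≡ ⟩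
  map (nth v) (range (length v))     ≡⟨ map-nth-range v ⟩
  v                                  ∎
  where
  open ≡-Reasoning

posOf-correct : ∀ w {x} → x ∈ w → 1≤ posOf w x ≤ length w × nth w (posOf w x) ≡ x
posOf-correct (a ∷ w) {x} x∈ with a ≡ᵇ x in a≡ᵇx
... | true = (s≤s z≤n , s≤s z≤n) , invertʸ (≡ᵇ-reflects-≡ a x) a≡ᵇx
posOf-correct (a ∷ w) (here refl) | false = contradiction refl (invertⁿ (≡ᵇ-reflects-≡ a a) a≡ᵇx)
posOf-correct (a ∷ w) {x} (there x∈) | false with posOf-correct w x∈
... | (_ , pos≤) , nth≡ with posOf w x
... | suc k = (s≤s z≤n , s≤s pos≤) , nth≡

nth-injective : ∀ w → Unique w → ∀ {j k} → 1≤ j ≤ length w → 1≤ k ≤ length w → nth w j ≡ nth w k → j ≡ k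
nth-injective (x ∷ w) _ {1} {1} _ _ _ = refl
nth-injective (x ∷ w) (x∉w ∷ _) {1} {suc (suc k)} _ (_ , s≤s k≤) x≡ =
  contradiction x≡ (All.lookup x∉w (nth-∈ w (s≤s z≤n , k≤)))
nth-injective (x ∷ w) (x∉w ∷ _) {suc (suc j)} {1} (_ , s≤s j≤) _ ≡x =
  contradiction (sym ≡x) (All.lookup x∉w (nth-∈ w (s≤s z≤n , j≤)))
nth-injective (x ∷ w) (_ ∷ w-unique) {suc (suc j)} {suc (suc k)} (_ , s≤s j≤) (_ , s≤s k≤) nth≡ =
  cong suc (nth-injective w w-unique (s≤s z≤n , j≤) (s≤s z≤n , k≤) nth≡)

posOf-nth : ∀ w → Unique w → ∀ {j} → 1≤ j ≤ length w → posOf w (nth w j) ≡ j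
posOf-nth w w-unique j-pos =
  let (pos-pos , nth≡) = posOf-correct w (nth-∈ w j-pos) in nth-injective w w-unique pos-pos j-pos nth≡

IsPermutation : List ℕ → Set
IsPermutation w = range (length w) ↭ w

module Permutation {w : List ℕ} (w-perm : IsPermutation w) where

  unique : Unique w
  unique = SetoidPermutation.Unique-resp-↭ (≡-setoid ℕ) (↭⇒↭ₛ w-perm) (unique-range (length w))

  entry-range : ∀ {x} → x ∈ w → 1≤ x ≤ length w
  entry-range x∈ = ∈-range⁻ (∈-resp-↭ (↭-sym w-perm) x∈)

  range-entry : ∀ {x} → 1≤ x ≤ length w → x ∈ w
  range-entry x-pos = ∈-resp-↭ w-perm (∈-range⁺ x-pos)

-- Right-to-left maxima and blocks

module _ (w : List ℕ) where

  isRLmax⇒> : ∀ {i j} → isRLmax w i ≡ true → i < j → j ≤ length w → nth w j < nth w i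
  isRLmax⇒> {i} {j} i-max i<j j≤ with all-true⁻ _ (range (length w)) i-max (∈-range⁺ (≤-trans (s≤s z≤n) i<j , j≤))
  ... | holds with i <ᵇ j | reflectʸ (<ᵇ-reflects-< i j) i<j
  ... | .true | refl = invertʸ (<ᵇ-reflects-< _ _) holds

  isRLmax-false⇒ : ∀ {i} → isRLmax w i ≡ false → ∃ λ j → i < j × j ≤ length w × nth w i ≤ nth w j
  isRLmax-false⇒ {i} i-not-max with all-false⁻ _ (range (length w)) i-not-max
  ... | j , j∈ , fails with i <ᵇ j in i<ᵇj
  ... | true = j , invertʸ (<ᵇ-reflects-< i j) i<ᵇj , proj₂ (∈-range⁻ j∈) , ≮⇒≥ (invertⁿ (<ᵇ-reflects-< _ _) fails)

  >⇒isRLmax : ∀ {i} → (∀ {j} → i < j → j ≤ length w → nth w j < nth w i) → isRLmax w i ≡ true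
  >⇒isRLmax {i} later< with isRLmax w i in i-max
  ... | true = refl
  ... | false = let (j , i<j , j≤ , ≤nth) = isRLmax-false⇒ i-max in contradiction ≤nth (<⇒≱ (later< i<j j≤))

  isRLmax-last : isRLmax w (length w) ≡ true
  isRLmax-last = >⇒isRLmax λ len<j j≤len → contradiction j≤len (<⇒≱ len<j)

  lastRLmax : ℕ → ℕ
  lastRLmax zero = zero
  lastRLmax (suc k) = if isRLmax w (suc k) then suc k else lastRLmax k

  lastRLmax-≤ : ∀ k → lastRLmax k ≤ k
  lastRLmax-≤ zero = z≤n
  lastRLmax-≤ (suc k) with isRLmax w (suc k)
  ... | true = ≤-refl
  ... | false = m≤n⇒m≤1+n (lastRLmax-≤ k)

  lastRLmax-gap : ∀ {k p} → lastRLmax k < p → p ≤ k → isRLmax w p ≡ false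
  lastRLmax-gap {zero} last<p p≤k = contradiction p≤k (<⇒≱ last<p)
  lastRLmax-gap {suc k} last<p p≤k with isRLmax w (suc k) in k-max
  ... | true = contradiction p≤k (<⇒≱ last<p)
  ... | false with m≤n⇒m<n∨m≡n p≤k
  ... | inj₁ p≤k′ = lastRLmax-gap last<p (≤-pred p≤k′)
  ... | inj₂ refl = k-max

  lastRLmax-≡ : ∀ {a b} → isRLmax w a ≡ true ⊎ a ≡ 0 → a ≤ b →
    (∀ {p} → a < p → p ≤ b → isRLmax w p ≡ false) → lastRLmax b ≡ a
  lastRLmax-≡ {a} {b} a-max a≤b none with m≤n⇒m<n∨m≡n a≤b
  lastRLmax-≡ {zero} {.zero} _ _ _ | inj₂ refl = refl
  lastRLmax-≡ {suc a} {.(suc a)} (inj₁ a-max) _ _ | inj₂ refl rewrite a-max = refl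
  lastRLmax-≡ {a} {suc b} a-max a≤b none | inj₁ a<b rewrite none a<b ≤-refl =
    lastRLmax-≡ a-max (≤-pred a<b) λ a<p p≤b → none a<p (m≤n⇒m≤1+n p≤b)

  blockStart : ℕ → ℕ
  blockStart j = suc (lastRLmax (j ∸ 1))

  blockStart-≤ : ∀ {j} → 1 ≤ j → blockStart j ≤ j
  blockStart-≤ {suc j} _ = s≤s (lastRLmax-≤ j)

  record NextRLmax (j : ℕ) : Set where
    field
      pos : ℕ
      j≤pos : j ≤ pos
      pos≤length : pos ≤ length w
      isRL : isRLmax w pos ≡ true
      none-before : ∀ {p} → j ≤ p → p < pos → isRLmax w p ≡ false

  nextRLmax : ∀ j → j ≤ length w → NextRLmax j
  nextRLmax j j≤ = search (length w ∸ j) j (m+[n∸m]≡n j≤)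
    where
    search : ∀ d j → j + d ≡ length w → NextRLmax j
    search zero j j+0≡ = record
      { pos = j ; j≤pos = ≤-refl ; pos≤length = ≤-reflexive (trans (sym (+-identityʳ j)) j+0≡)
      ; isRL = subst (λ p → isRLmax w p ≡ true) (trans (sym j+0≡) (+-identityʳ j)) isRLmax-last
      ; none-before = λ j≤p p<j → contradiction j≤p (<⇒≱ p<j) }
    search (suc d) j j+d≡ with isRLmax w j in j-max
    ... | true = record
      { pos = j ; j≤pos = ≤-refl ; pos≤length = subst (j ≤_) j+d≡ (m≤m+n j (suc d)) ; isRL = j-max
      ; none-before = λ j≤p p<j → contradiction j≤p (<⇒≱ p<j) }
    ... | false = record
      { pos = pos ; j≤pos = <⇒≤ j≤pos ; pos≤length = pos≤length ; isRL = isRL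
      ; none-before = λ {p} j≤p p<pos → case m≤n⇒m<n∨m≡n j≤p of λ where
          (inj₁ j<p) → none-before j<p p<pos
          (inj₂ refl) → j-max }
      where
      open NextRLmax (search d (suc j) (trans (sym (+-suc j d)) j+d≡))

  nth≤nextRLmax : ∀ {j p} → isRLmax w j ≡ true → j ≤ length w → p ≤ j →
    (∀ {q} → p ≤ q → q < j → isRLmax w q ≡ false) → nth w p ≤ nth w j
  nth≤nextRLmax {j} {p} j-max j≤ p≤j none = bound (j ∸ p) p ≤-refl p≤j none
    where
    bound : ∀ fuel p → j ∸ p ≤ fuel → p ≤ j → (∀ {q} → p ≤ q → q < j → isRLmax w q ≡ false) → nth w p ≤ nth w j
    bound fuel p gap p≤j none with m≤n⇒m<n∨m≡n p≤j
    ... | inj₂ refl = ≤-refl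
    bound zero p gap p≤j none | inj₁ p<j = contradiction gap (<⇒≱ (m<n⇒0<n∸m p<j))
    bound (suc fuel) p gap p≤j none | inj₁ p<j with isRLmax-false⇒ (none ≤-refl p<j)
    ... | q , p<q , q≤ , p≤q with <-cmp q j
    ... | tri< q<j _ _ = ≤-trans p≤q (bound fuel q (≤-pred (≤-trans (∸-monoʳ-< p<q (<⇒≤ q<j)) gap)) (<⇒≤ q<j)
                                         λ q≤r r<j → none (≤-trans (<⇒≤ p<q) q≤r) r<j)
    ... | tri≈ _ refl _ = p≤q
    ... | tri> _ _ j<q = ≤-trans p≤q (<⇒≤ (isRLmax⇒> j-max j<q q≤))

  ≤-blockMax : ∀ {j p} → isRLmax w j ≡ true → 1≤ j ≤ length w → blockStart j ≤ p → p ≤ j → nth w p ≤ nth w j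
  ≤-blockMax {suc j} j-max (_ , j≤) start≤p p≤j = nth≤nextRLmax j-max j≤ p≤j
    λ p≤q q<j → lastRLmax-gap (≤-trans start≤p p≤q) (≤-pred q<j)

-- The map Φ sending the blocks of a word to cycles

module _ (w : List ℕ) where

  next : ℕ → ℕ
  next j = if isRLmax w j then blockStart w j else suc j

  Φ : List ℕ
  Φ = map (λ v → nth w (next (posOf w v))) (range (length w))

  next^ : ℕ → ℕ → ℕ
  next^ zero j = j
  next^ (suc k) j = next (next^ k j)

  next-isRLmax : ∀ {j} → isRLmax w j ≡ true → next j ≡ blockStart w j
  next-isRLmax j-max rewrite j-max = refl

  next-notRLmax : ∀ {j} → isRLmax w j ≡ false → next j ≡ suc j
  next-notRLmax j-not-max rewrite j-not-max = refl

  notRLmax⇒<length : ∀ {j} → isRLmax w j ≡ false → j < length w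
  notRLmax⇒<length {j} j-not-max with <-cmp j (length w)
  ... | tri< j<len _ _ = j<len
  ... | tri≈ _ refl _ = contradiction (trans (sym (isRLmax-last w)) j-not-max) λ ()
  ... | tri> _ _ len<j = contradiction
          (trans (sym (>⇒isRLmax w λ j<k k≤ → contradiction k≤ (<⇒≱ (<-trans len<j j<k)))) j-not-max) λ ()

  next-range : ∀ {j} → 1≤ j ≤ length w → 1≤ next j ≤ length w
  next-range {j} (1≤j , j≤) with isRLmax w j in j-max
  ... | true = s≤s z≤n , ≤-trans (blockStart-≤ w 1≤j) j≤
  ... | false = s≤s z≤n , notRLmax⇒<length j-max

  next^-range : ∀ k {j} → 1≤ j ≤ length w → 1≤ next^ k j ≤ length w
  next^-range zero j-pos = j-pos
  next^-range (suc k) j-pos = next-range (next^-range k j-pos)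

  length-Φ : length Φ ≡ length w
  length-Φ = trans (length-map _ (range (length w))) (length-range (length w))

  orbit-isRLmax : ∀ {j} → isRLmax w j ≡ true → 1 ≤ j → ∀ k → blockStart w j ≤ next^ k j × next^ k j ≤ j
  orbit-isRLmax {suc j} j-max _ zero = blockStart-≤ w (s≤s z≤n) , ≤-refl
  orbit-isRLmax {suc j} j-max 1≤j (suc k) with orbit-isRLmax j-max 1≤j k
  ... | start≤ , ≤j with m≤n⇒m<n∨m≡n ≤j
  ... | inj₂ at-j rewrite at-j | next-isRLmax j-max = ≤-refl , blockStart-≤ w 1≤j
  ... | inj₁ below-j rewrite next-notRLmax (lastRLmax-gap w start≤ (≤-pred below-j)) = m≤n⇒m≤1+n start≤ , below-j

  orbit-notRLmax : ∀ {j} (N : NextRLmax w j) → ∀ k → j + k ≤ NextRLmax.pos N → next^ k j ≡ j + k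
  orbit-notRLmax {j} N zero _ = sym (+-identityʳ j)
  orbit-notRLmax {j} N (suc k) j+k<pos
    rewrite orbit-notRLmax N k (≤-trans (+-monoʳ-≤ j (n≤1+n k)) j+k<pos) =
    trans (next-notRLmax (NextRLmax.none-before N (m≤m+n j k) (subst (_≤ NextRLmax.pos N) (+-suc j k) j+k<pos)))
          (sym (+-suc j k))

  next-blockEnd : ∀ {j} → isRLmax w j ≡ true ⊎ j ≡ 0 → (N : NextRLmax w (suc j)) → next (NextRLmax.pos N) ≡ suc j
  next-blockEnd {j} j-max N = trans (next-isRLmax isRL) (cong suc (lastRLmax-≡ w j-max (∸-monoˡ-≤ 1 j≤pos)
    λ j<p p≤ → none-before j<p (subst (_ <_) (m+[n∸m]≡n (≤-trans (s≤s z≤n) j≤pos)) (s≤s p≤))))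
    where open NextRLmax N

  next-surjective : ∀ {q} → 1≤ q ≤ length w → ∃ λ p → 1≤ p ≤ length w × next p ≡ q
  next-surjective {suc j} (_ , q≤) = case-prev j refl
    where
    via-blockEnd : isRLmax w j ≡ true ⊎ j ≡ 0 → ∃ λ p → 1≤ p ≤ length w × next p ≡ suc j
    via-blockEnd j-max = let N = nextRLmax w (suc j) q≤ in
      NextRLmax.pos N , (≤-trans (s≤s z≤n) (NextRLmax.j≤pos N) , NextRLmax.pos≤length N) , next-blockEnd j-max N
    case-prev : ∀ i → i ≡ j → ∃ λ p → 1≤ p ≤ length w × next p ≡ suc j
    case-prev zero refl = via-blockEnd (inj₂ refl)
    case-prev (suc i) refl with isRLmax w (suc i) in i-max
    ... | true = via-blockEnd (inj₁ i-max)
    ... | false = suc i , (s≤s z≤n , <⇒≤ q≤) , next-notRLmax i-max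

isCycleMax : List ℕ → ℕ → Bool
isCycleMax π t = all (λ k → iter π k t ≤ᵇ t) (upTo (length π))

module _ {w : List ℕ} (w-perm : IsPermutation w) where
  open Permutation w-perm

  Φ-nth : ∀ {j} → 1≤ j ≤ length w → nth (Φ w) (nth w j) ≡ nth w (next w j)
  Φ-nth j-pos = trans (nth-map-range _ (length w) (entry-range (nth-∈ w j-pos)))
                      (cong (nth w ∘ next w) (posOf-nth w unique j-pos))

  iter-Φ-nth : ∀ k {j} → 1≤ j ≤ length w → iter (Φ w) k (nth w j) ≡ nth w (next^ w k j)
  iter-Φ-nth zero j-pos = refl
  iter-Φ-nth (suc k) j-pos = trans (cong (nth (Φ w)) (iter-Φ-nth k j-pos)) (Φ-nth (next^-range w k j-pos))

  nth<nextRLmax : ∀ {j} → 1≤ j ≤ length w → isRLmax w j ≡ false → (N : NextRLmax w j) → nth w j < nth w (NextRLmax.pos N)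
  nth<nextRLmax j-pos j-not-max N = ≤∧≢⇒<
    (nth≤nextRLmax w isRL pos≤length j≤pos none-before)
    λ nth≡ → contradiction (trans (sym j-not-max) (subst (λ p → isRLmax w p ≡ true)
               (sym (nth-injective w unique j-pos (≤-trans (proj₁ j-pos) j≤pos , pos≤length) nth≡)) isRL)) λ ()
    where open NextRLmax N

  isCycleMax-Φ : ∀ {j} → 1≤ j ≤ length w → isCycleMax (Φ w) (nth w j) ≡ isRLmax w j
  isCycleMax-Φ {j} j-pos with isRLmax w j in j-max
  ... | true = all-true⁺ _ (upTo (length (Φ w))) λ {k} _ →
    let (start≤ , ≤j) = orbit-isRLmax w j-max (proj₁ j-pos) k in
    trans (cong (_≤ᵇ nth w j) (iter-Φ-nth k j-pos))
          (reflectʸ (≤ᵇ-reflects-≤ _ _) (≤-blockMax w j-max j-pos start≤ ≤j))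
  ... | false = all-false⁺ _ (upTo (length (Φ w))) (∈-upTo⁺ k<length)
    (trans (cong (_≤ᵇ nth w j) (trans (iter-Φ-nth k j-pos)
                                     (cong (nth w) (trans (orbit-notRLmax w N k (≤-reflexive j+k≡)) j+k≡))))
           (reflectⁿ (≤ᵇ-reflects-≤ _ _) (<⇒≱ (nth<nextRLmax j-pos j-max N))))
    where
    N = nextRLmax w j (proj₂ j-pos)
    open NextRLmax N
    k = pos ∸ j
    j+k≡ : j + k ≡ pos
    j+k≡ = m+[n∸m]≡n j≤pos
    k<length : k < length (Φ w)
    k<length = subst (k <_) (sym (length-Φ w)) (<-≤-trans (∸-monoʳ-< (proj₁ j-pos) j≤pos) pos≤length)

-- j ends a block of length one iff j ∸ 1 is 0 or ends a block too (lastRLmax w 0 = 0)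
isSingletonBlock : List ℕ → ℕ → Bool
isSingletonBlock w j = isRLmax w j ∧ (lastRLmax w (j ∸ 1) ≡ᵇ j ∸ 1)

oneGaps-isSingletonBlock : ∀ w m d →
  oneGaps (lastRLmax w m) (filterᵇ (isRLmax w) (interval (suc m) d)) ≡ count (isSingletonBlock w) (interval (suc m) d)
oneGaps-isSingletonBlock w m zero = refl
oneGaps-isSingletonBlock w m (suc d) = step (isRLmax w (suc m)) refl
  where
  open ≡-Reasoning
  rest = interval (suc (suc m)) d
  last = lastRLmax w m
  indicator : Bool → ℕ
  indicator b = if b then 1 else 0
  ∸≡ᵇ1 : ∀ {x m} → x ≤ m → ((suc m ∸ x) ≡ᵇ 1) ≡ (x ≡ᵇ m)
  ∸≡ᵇ1 {zero} {zero} _ = refl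
  ∸≡ᵇ1 {zero} {suc m} _ = refl
  ∸≡ᵇ1 {suc x} {suc m} (s≤s x≤m) = ∸≡ᵇ1 x≤m
  IH : ∀ {prev} → lastRLmax w (suc m) ≡ prev → oneGaps prev (filterᵇ (isRLmax w) rest) ≡ count (isSingletonBlock w) rest
  IH refl = oneGaps-isSingletonBlock w (suc m) d
  step : ∀ b → isRLmax w (suc m) ≡ b →
    oneGaps last (filterᵇ (isRLmax w) (suc m ∷ rest)) ≡ count (isSingletonBlock w) (suc m ∷ rest)
  step true m-max = begin
    oneGaps last (filterᵇ (isRLmax w) (suc m ∷ rest))
      ≡⟨ cong (oneGaps last) (filterᵇ-accept (isRLmax w) rest m-max) ⟩
    indicator ((suc m ∸ last) ≡ᵇ 1) + oneGaps (suc m) (filterᵇ (isRLmax w) rest)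
      ≡⟨ cong₂ _+_ (cong indicator (∸≡ᵇ1 (lastRLmax-≤ w m)))
                   (IH (lastRLmax-≡ w (inj₁ m-max) ≤-refl λ m<p p≤m → contradiction p≤m (<⇒≱ m<p))) ⟩
    indicator (last ≡ᵇ m) + count (isSingletonBlock w) rest
      ≡⟨ cong (λ b → indicator (b ∧ (last ≡ᵇ m)) + count (isSingletonBlock w) rest) m-max ⟨
    indicator (isSingletonBlock w (suc m)) + count (isSingletonBlock w) rest
      ≡⟨ count-∷ (isSingletonBlock w) (suc m) rest ⟨
    count (isSingletonBlock w) (suc m ∷ rest) ∎
  step false m-not-max = begin
    oneGaps last (filterᵇ (isRLmax w) (suc m ∷ rest))
      ≡⟨ cong (oneGaps last) (filterᵇ-reject (isRLmax w) rest m-not-max) ⟩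
    oneGaps last (filterᵇ (isRLmax w) rest)
      ≡⟨ IH (cong (if_then suc m else last) m-not-max) ⟩
    count (isSingletonBlock w) rest
      ≡⟨ cong (λ b → indicator (b ∧ (last ≡ᵇ m)) + count (isSingletonBlock w) rest) m-not-max ⟨
    indicator (isSingletonBlock w (suc m)) + count (isSingletonBlock w) rest
      ≡⟨ count-∷ (isSingletonBlock w) (suc m) rest ⟨
    count (isSingletonBlock w) (suc m ∷ rest) ∎

next≡ᵇ-isSingletonBlock : ∀ w {j} → 1 ≤ j → (next w j ≡ᵇ j) ≡ isSingletonBlock w j
next≡ᵇ-isSingletonBlock w {suc m} _ with isRLmax w (suc m)
... | true = refl
... | false = reflectⁿ (≡ᵇ-reflects-≡ (suc (suc m)) (suc m)) 1+n≢n

isAscent : List ℕ → ℕ → Bool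
isAscent w i = nth w i <ᵇ nth w (suc i)

count-isAscent : ∀ w → count (isAscent w) (range (length w)) ≡ asc w
count-isAscent w = drop-last (length w) refl
  where
  open ≡-Reasoning
  drop-last : ∀ n → n ≡ length w → count (isAscent w) (range n) ≡ count (isAscent w) (range (n ∸ 1))
  drop-last zero _ = refl
  drop-last (suc m) sm≡ = begin
    count (isAscent w) (range (suc m))                       ≡⟨ cong (count (isAscent w)) (range-suc m) ⟩
    count (isAscent w) (range m ++ [ suc m ])                ≡⟨ count-++ (isAscent w) (range m) [ suc m ] ⟩
    count (isAscent w) (range m) + count (isAscent w) [ suc m ] ≡⟨ cong (count (isAscent w) (range m) +_) last-not-ascent ⟩
    count (isAscent w) (range m) + 0                         ≡⟨ +-identityʳ _ ⟩
    count (isAscent w) (range m)                             ∎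
    where
    -- position n is no ascent because nth returns 0 beyond the word
    last-not-ascent : count (isAscent w) [ suc m ] ≡ 0
    last-not-ascent rewrite nth-beyond w (suc (suc m)) (≤-reflexive (cong suc (sym sm≡))) = refl

module _ {w : List ℕ} (w-perm : IsPermutation w) where
  open Permutation w-perm

  count-nth : ∀ p → count p (range (length w)) ≡ count (p ∘ nth w) (range (length w))
  count-nth p = begin
    count p (range (length w))                     ≡⟨ count-↭ p (↭-trans w-perm (↭-reflexive (sym (map-nth-range w)))) ⟩
    count p (map (nth w) (range (length w)))       ≡⟨ count-map p (nth w) (range (length w)) ⟩
    count (p ∘ nth w) (range (length w))           ∎
    where open ≡-Reasoning

  count-Φ : ∀ p → count p (range (length (Φ w))) ≡ count (p ∘ nth w) (range (length w))
  count-Φ p = trans (cong (count p ∘ range) (length-Φ w)) (count-nth p)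

  cyc-Φ : cyc (Φ w) ≡ bk w
  cyc-Φ = trans (count-Φ (isCycleMax (Φ w))) (count-cong-∈ _ (isCycleMax-Φ w-perm ∘ ∈-range⁻))

  exc-Φ : exc (Φ w) ≡ asc w
  exc-Φ = trans (count-Φ _) (trans (count-cong-∈ _ (excedance≡ascent ∘ ∈-range⁻)) (count-isAscent w))
    where
    excedance≡ascent : ∀ {j} → 1≤ j ≤ length w → (nth w j <ᵇ nth (Φ w) (nth w j)) ≡ isAscent w j
    excedance≡ascent {j} j-pos rewrite Φ-nth w-perm j-pos with isRLmax w j in j-max
    ... | false = refl
    ... | true = trans (reflectⁿ (<ᵇ-reflects-< _ _) (≤⇒≯ (≤-blockMax w j-max j-pos ≤-refl (blockStart-≤ w (proj₁ j-pos)))))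
                       (sym (reflectⁿ (<ᵇ-reflects-< _ _) (≤⇒≯ next≤)))
      where
      next≤ : nth w (suc j) ≤ nth w j
      next≤ with m≤n⇒m<n∨m≡n (proj₂ j-pos)
      ... | inj₁ j<len = <⇒≤ (isRLmax⇒> w j-max ≤-refl j<len)
      ... | inj₂ refl = subst (_≤ nth w j) (sym (nth-beyond w (suc j) ≤-refl)) z≤n

  fix-Φ : fix (Φ w) ≡ bkone w
  fix-Φ = begin
    fix (Φ w)                                              ≡⟨ count-Φ _ ⟩
    count (λ j → nth (Φ w) (nth w j) ≡ᵇ nth w j) (range (length w)) ≡⟨ count-cong-∈ _ (fixed≡singleton ∘ ∈-range⁻) ⟩
    count (isSingletonBlock w) (range (length w))          ≡⟨ cong (count (isSingletonBlock w)) (range-interval (length w)) ⟩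
    count (isSingletonBlock w) (interval 1 (length w))     ≡⟨ oneGaps-isSingletonBlock w 0 (length w) ⟨
    oneGaps 0 (filterᵇ (isRLmax w) (interval 1 (length w)))
      ≡⟨ cong (oneGaps 0 ∘ filterᵇ (isRLmax w)) (range-interval (length w)) ⟨
    bkone w                                                ∎
    where
    open ≡-Reasoning
    fixed≡singleton : ∀ {j} → 1≤ j ≤ length w → (nth (Φ w) (nth w j) ≡ᵇ nth w j) ≡ isSingletonBlock w j
    fixed≡singleton j-pos rewrite Φ-nth w-perm j-pos =
      trans (reflects-≡ (≡ᵇ-reflects-≡ _ _) (≡ᵇ-reflects-≡ _ _)
                        (nth-injective w unique (next-range w j-pos) j-pos) (cong (nth w)))
            (next≡ᵇ-isSingletonBlock w (proj₁ j-pos))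

module _ {w : List ℕ} (w-perm : IsPermutation w) (1≤len : 1 ≤ length w) where
  open Permutation w-perm

  private
    n = length w

  posMax : ℕ
  posMax = posOf w n

  posMax-range : 1≤ posMax ≤ n
  posMax-range = proj₁ (posOf-correct w (range-entry (1≤len , ≤-refl)))

  nth-posMax : nth w posMax ≡ n
  nth-posMax = proj₂ (posOf-correct w (range-entry (1≤len , ≤-refl)))

  posMax-isRLmax : isRLmax w posMax ≡ true
  posMax-isRLmax = >⇒isRLmax w λ {j} posMax<j j≤ →
    let j-pos = ≤-trans (s≤s z≤n) posMax<j , j≤ in
    ≤∧≢⇒< (subst (nth w j ≤_) (sym nth-posMax) (proj₂ (entry-range (nth-∈ w j-pos))))
          λ nth≡ → <-irrefl (sym (nth-injective w unique j-pos posMax-range nth≡)) posMax<j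

  notRLmax-before-posMax : ∀ {p} → 1 ≤ p → p < posMax → isRLmax w p ≡ false
  notRLmax-before-posMax {p} 1≤p p<posMax with isRLmax w p in p-max
  ... | false = refl
  ... | true = contradiction (proj₂ (entry-range (nth-∈ w (1≤p , ≤-trans (<⇒≤ p<posMax) (proj₂ posMax-range)))))
                 (<⇒≱ (subst (_< nth w p) nth-posMax (isRLmax⇒> w p-max p<posMax (proj₂ posMax-range))))

  firstRLmax : NextRLmax w 1
  firstRLmax = record { pos = posMax ; j≤pos = proj₁ posMax-range ; pos≤length = proj₂ posMax-range
                      ; isRL = posMax-isRLmax ; none-before = notRLmax-before-posMax }

  next^-posMax : ∀ k → k < posMax → next^ w (suc k) posMax ≡ suc k
  next^-posMax zero _ = next-blockEnd w (inj₂ refl) firstRLmax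
  next^-posMax (suc k) k<posMax =
    trans (cong (next w) (next^-posMax k (<⇒≤ k<posMax))) (next-notRLmax w (notRLmax-before-posMax (s≤s z≤n) k<posMax))

  nth-Φ-length : nth (Φ w) n ≡ nth w 1
  nth-Φ-length = trans (cong (nth (Φ w)) (sym nth-posMax))
    (trans (Φ-nth w-perm posMax-range) (cong (nth w) (next^-posMax 0 (proj₁ posMax-range))))

  iter-Φ-max : ∀ k → iter (Φ w) k n ≡ nth w (next^ w k posMax)
  iter-Φ-max k = trans (cong (iter (Φ w) k) (sym nth-posMax)) (iter-Φ-nth w-perm k posMax-range)

  fcyc-Φ : fcyc (Φ w) ≡ posMax
  fcyc-Φ = begin
    fcyc (Φ w)                                       ≡⟨ cong (λ m → count (inCycleOf m) (range m)) (length-Φ w) ⟩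
    count (inCycleOf n) (range n)                   ≡⟨ count-nth w-perm (inCycleOf n) ⟩
    count (inCycleOf n ∘ nth w) (range n)           ≡⟨ count-cong-∈ _ (inCycle≡ ∘ ∈-range⁻) ⟩
    count (_≤ᵇ posMax) (range n)                    ≡⟨ count-≤ᵇ-range posMax n ⟩
    posMax ⊓ n                                      ≡⟨ m≤n⇒m⊓n≡m (proj₂ posMax-range) ⟩
    posMax                                          ∎
    where
    open ≡-Reasoning
    inCycleOf : ℕ → ℕ → Bool
    inCycleOf m j = any (λ k → iter (Φ w) k m ≡ᵇ j) (upTo m)
    inCycle≡ : ∀ {q} → 1≤ q ≤ n → inCycleOf n (nth w q) ≡ (q ≤ᵇ posMax)
    inCycle≡ {q} q-pos = Bool-ext
      (λ in-cycle → let (k , _ , iter≡) = any-true⁻ _ (upTo n) in-cycle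
                        q≡ = nth-injective w unique (next^-range w k posMax-range) q-pos
                               (trans (sym (iter-Φ-max k)) (invertʸ (≡ᵇ-reflects-≡ _ _) iter≡))
                    in reflectʸ (≤ᵇ-reflects-≤ q posMax)
                         (subst (_≤ posMax) q≡ (proj₂ (orbit-isRLmax w posMax-isRLmax (proj₁ posMax-range) k))))
      λ q≤ᵇ → case m≤n⇒m<n∨m≡n (invertʸ (≤ᵇ-reflects-≤ q posMax) q≤ᵇ) of λ where
        (inj₂ refl) → any-true⁺ _ (upTo n) (∈-upTo⁺ 1≤len) (reflectʸ (≡ᵇ-reflects-≡ _ _) (sym nth-posMax))
        (inj₁ q<posMax) → reached q-pos q<posMax
      where
      reached : ∀ {q} → 1≤ q ≤ n → q < posMax → inCycleOf n (nth w q) ≡ true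
      reached {suc k} _ q<posMax = any-true⁺ _ (upTo n) (∈-upTo⁺ (<-≤-trans q<posMax (proj₂ posMax-range)))
        (reflectʸ (≡ᵇ-reflects-≡ _ _) (trans (iter-Φ-max (suc k)) (cong (nth w) (next^-posMax k (<⇒≤ q<posMax)))))

  fbk≡posMax : fbk w ≡ posMax
  fbk≡posMax =
    let (rest , ≡posMax∷rest) = filterᵇ-interval-first (isRLmax w) 1 n (proj₁ posMax-range) (s≤s (proj₂ posMax-range))
                                  posMax-isRLmax notRLmax-before-posMax
    in first (trans (cong (filterᵇ (isRLmax w)) (range-interval n)) ≡posMax∷rest)
    where
    first : ∀ {i is} → rlPos w ≡ i ∷ is → fbk w ≡ i
    first rlPos≡ with rlPos w
    first refl | _ = refl

  -- The cycle of n is (w₁, …, w_(posMax ∸ 1), n), and the last comparison w_(posMax ∸ 1) < n made by isQ is automatic.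
  isQ≡isQhat-Φ : isQ n w ≡ isQhat n (Φ w)
  isQ≡isQhat-Φ = begin
    isQ n w                                                            ≡⟨ drop-last-ascent posMax refl ⟩
    all (isAscent w) (range (posMax ∸ 2))                              ≡⟨ all-cong-∈ _ (orbit-step ∘ ∈-range⁻) ⟨
    all (λ m → iter (Φ w) m n <ᵇ iter (Φ w) (suc m) n) (range (posMax ∸ 2))
      ≡⟨ cong (λ p → all (λ m → iter (Φ w) m n <ᵇ iter (Φ w) (suc m) n) (range (p ∸ 2))) fcyc-Φ ⟨
    isQhat n (Φ w)                                                     ∎
    where
    open ≡-Reasoning
    m≤n∸2⇒1+m<n : ∀ {m n} → 1 ≤ m → m ≤ n ∸ 2 → suc m < n
    m≤n∸2⇒1+m<n {suc m} {suc (suc n)} _ m≤ = s≤s (s≤s m≤)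
    orbit-step : ∀ {m} → 1≤ m ≤ posMax ∸ 2 → (iter (Φ w) m n <ᵇ iter (Φ w) (suc m) n) ≡ isAscent w m
    orbit-step {suc m} (1≤m , m≤) = let 2+m<posMax = m≤n∸2⇒1+m<n 1≤m m≤ in cong₂ _<ᵇ_
      (trans (iter-Φ-max (suc m)) (cong (nth w) (next^-posMax m (<⇒≤ (<⇒≤ 2+m<posMax)))))
      (trans (iter-Φ-max (suc (suc m))) (cong (nth w) (next^-posMax (suc m) (<⇒≤ 2+m<posMax))))
    ascent-into-max : ∀ {k} → suc (suc k) ≡ posMax → isAscent w (suc k) ≡ true
    ascent-into-max {k} ≡posMax =
      let k-pos = s≤s z≤n , ≤-trans (n≤1+n (suc k)) (subst (_≤ n) (sym ≡posMax) (proj₂ posMax-range)) in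
      reflectʸ (<ᵇ-reflects-< _ _) (subst (nth w (suc k) <_) (sym (trans (cong (nth w) ≡posMax) nth-posMax))
        (≤∧≢⇒< (proj₂ (entry-range (nth-∈ w k-pos)))
               λ nth≡n → 1+n≢n (sym (trans (nth-injective w unique k-pos posMax-range (trans nth≡n (sym nth-posMax)))
                                           (sym ≡posMax)))))
    drop-last-ascent : ∀ p → p ≡ posMax → all (isAscent w) (range (p ∸ 1)) ≡ all (isAscent w) (range (p ∸ 2))
    drop-last-ascent zero _ = refl
    drop-last-ascent (suc zero) _ = refl
    drop-last-ascent (suc (suc k)) ≡posMax = begin
      all (isAscent w) (range (suc k))                              ≡⟨ cong (all (isAscent w)) (range-suc k) ⟩
      all (isAscent w) (range k ++ [ suc k ])                       ≡⟨ all-++ (isAscent w) (range k) [ suc k ] ⟩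
      all (isAscent w) (range k) ∧ (isAscent w (suc k) ∧ true)
        ≡⟨ cong (λ b → all (isAscent w) (range k) ∧ (b ∧ true)) (ascent-into-max ≡posMax) ⟩
      all (isAscent w) (range k) ∧ true                             ≡⟨ ∧-identityʳ _ ⟩
      all (isAscent w) (range k)                                    ∎

-- Φ is a bijection of 𝔖ₙ

record GreatestCycleMaxBelow (π : List ℕ) (x t : ℕ) : Set where
  field
    in-range : 1≤ t ≤ length π
    isMax : isCycleMax π t ≡ true
    <x : t < x
    greatest : ∀ {s} → 1≤ s ≤ length π → isCycleMax π s ≡ true → s < x → s ≤ t

greatestCycleMaxBelow-unique : ∀ {π x t u} → GreatestCycleMaxBelow π x t → GreatestCycleMaxBelow π x u → t ≡ u
greatestCycleMaxBelow-unique T U =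
  ≤-antisym (greatest U (in-range T) (isMax T) (<x T)) (greatest T (in-range U) (isMax U) (<x U))
  where open GreatestCycleMaxBelow

module _ {w : List ℕ} (w-perm : IsPermutation w) where
  open Permutation w-perm

  Φ-permutation : range (length w) ↭ Φ w
  Φ-permutation = unique∧⊆∧length⇒↭ (unique-range (length w)) range⊆Φ
    (≤-reflexive (trans (length-Φ w) (sym (length-range (length w)))))
    where
    range⊆Φ : range (length w) ⊆ Φ w
    range⊆Φ {u} u∈ =
      let (q-pos , nth≡u) = posOf-correct w (range-entry (∈-range⁻ u∈))
          (p , p-pos , next≡q) = next-surjective w q-pos
      in subst (_∈ Φ w) (trans (cong (nth w ∘ next w) (posOf-nth w unique p-pos)) (trans (cong (nth w) next≡q) nth≡u))
           (∈-map⁺ _ (∈-range⁺ (entry-range (nth-∈ w p-pos))))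

  blockEnd-greatestCycleMaxBelow : ∀ {j} → isRLmax w j ≡ true → 1≤ j ≤ length w → (N : NextRLmax w (suc j)) →
    GreatestCycleMaxBelow (Φ w) (nth w j) (nth w (NextRLmax.pos N))
  blockEnd-greatestCycleMaxBelow {j} j-max j-pos N = record
    { in-range = subst (1≤ nth w pos ≤_) (sym (length-Φ w)) (entry-range (nth-∈ w pos-range))
    ; isMax = trans (isCycleMax-Φ w-perm pos-range) isRL
    ; <x = isRLmax⇒> w j-max j≤pos pos≤length
    ; greatest = λ {s} → below ∘ subst (1≤ s ≤_) (length-Φ w)
    }
    where
    open NextRLmax N
    pos-range : 1≤ pos ≤ length w
    pos-range = ≤-trans (s≤s z≤n) j≤pos , pos≤length
    below : ∀ {s} → 1≤ s ≤ length w → isCycleMax (Φ w) s ≡ true → s < nth w j → s ≤ nth w pos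
    below {s} s-pos s-max s<
      with (p-pos , nth≡s) ← posOf-correct w (range-entry s-pos)
      with p ← posOf w s | refl ← nth≡s
      with p-max ← trans (sym (isCycleMax-Φ w-perm p-pos)) s-max
      with <-cmp p j
    ... | tri< p<j _ _ = contradiction s< (<-asym (isRLmax⇒> w p-max p<j (proj₂ j-pos)))
    ... | tri≈ _ refl _ = contradiction s< (<-irrefl refl)
    ... | tri> _ _ j<p with <-cmp p pos
    ...   | tri< p<pos _ _ = contradiction (trans (sym p-max) (none-before j<p p<pos)) λ ()
    ...   | tri≈ _ refl _ = ≤-refl
    ...   | tri> _ _ pos<p = <⇒≤ (isRLmax⇒> w isRL pos<p (proj₂ p-pos))

module _ {w v : List ℕ} (w-perm : IsPermutation w) (v-perm : IsPermutation v) (Φ≡ : Φ w ≡ Φ v) where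

  private
    n = length w
    len≡ : length v ≡ n
    len≡ = trans (sym (length-Φ v)) (trans (cong length (sym Φ≡)) (length-Φ w))
    v-range : ∀ {j} → 1≤ j ≤ n → 1≤ j ≤ length v
    v-range {j} = subst (1≤ j ≤_) (sym len≡)

  nth-Φ-injective : ∀ {j} → 1≤ j ≤ n → nth w j ≡ nth v j
  nth-Φ-injective {suc zero} (_ , 1≤n) = begin
    nth w 1              ≡⟨ nth-Φ-length w-perm 1≤n ⟨
    nth (Φ w) n          ≡⟨ cong₂ nth Φ≡ (sym len≡) ⟩
    nth (Φ v) (length v) ≡⟨ nth-Φ-length v-perm (subst (1 ≤_) (sym len≡) 1≤n) ⟩
    nth v 1              ∎
    where open ≡-Reasoning
  nth-Φ-injective {suc (suc j)} (_ , j<n) = step (nth-Φ-injective j-pos)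
    where
    open ≡-Reasoning
    j-pos : 1≤ suc j ≤ n
    j-pos = s≤s z≤n , <⇒≤ j<n
    step : nth w (suc j) ≡ nth v (suc j) → nth w (suc (suc j)) ≡ nth v (suc (suc j))
    step nth≡ with isRLmax w (suc j) in j-max-w | isRLmax v (suc j) in j-max-v
      | trans (sym (isCycleMax-Φ w-perm j-pos)) (trans (cong₂ isCycleMax Φ≡ nth≡) (isCycleMax-Φ v-perm (v-range j-pos)))
    ... | false | false | _ = begin
      nth w (suc (suc j))            ≡⟨ cong (nth w) (next-notRLmax w j-max-w) ⟨
      nth w (next w (suc j))         ≡⟨ Φ-nth w-perm j-pos ⟨
      nth (Φ w) (nth w (suc j))      ≡⟨ cong₂ nth Φ≡ nth≡ ⟩
      nth (Φ v) (nth v (suc j))      ≡⟨ Φ-nth v-perm (v-range j-pos) ⟩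
      nth v (next v (suc j))         ≡⟨ cong (nth v) (next-notRLmax v j-max-v) ⟩
      nth v (suc (suc j))            ∎
    ... | true | true | _ = begin
      nth w (suc (suc j))            ≡⟨ cong (nth w) (next-blockEnd w (inj₁ j-max-w) N) ⟨
      nth w (next w e)               ≡⟨ Φ-nth w-perm e-range ⟨
      nth (Φ w) (nth w e)            ≡⟨ cong₂ nth Φ≡ blockEnds≡ ⟩
      nth (Φ v) (nth v f)            ≡⟨ Φ-nth v-perm f-range ⟩
      nth v (next v f)               ≡⟨ cong (nth v) (next-blockEnd v (inj₁ j-max-v) M) ⟩
      nth v (suc (suc j))            ∎
      where
      N = nextRLmax w (suc (suc j)) j<n
      M = nextRLmax v (suc (suc j)) (subst (_ ≤_) (sym len≡) j<n)
      e = NextRLmax.pos N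
      f = NextRLmax.pos M
      e-range : 1≤ e ≤ n
      e-range = ≤-trans (s≤s z≤n) (NextRLmax.j≤pos N) , NextRLmax.pos≤length N
      f-range : 1≤ f ≤ length v
      f-range = ≤-trans (s≤s z≤n) (NextRLmax.j≤pos M) , NextRLmax.pos≤length M
      blockEnds≡ : nth w e ≡ nth v f
      blockEnds≡ = greatestCycleMaxBelow-unique
        (blockEnd-greatestCycleMaxBelow w-perm j-max-w j-pos N)
        (subst₂ (λ π x → GreatestCycleMaxBelow π x (nth v f)) (sym Φ≡) (sym nth≡)
          (blockEnd-greatestCycleMaxBelow v-perm j-max-v (v-range j-pos) M))

  Φ-injective : w ≡ v
  Φ-injective = nth-ext w v (sym len≡) nth-Φ-injective

Statistics : Set
Statistics = ℕ × ℕ × ℕ × ℕ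

blockStatistics : List ℕ → Statistics
blockStatistics σ = asc σ , bkone σ , bk σ , fbk σ

cycleStatistics : List ℕ → Statistics
cycleStatistics σ = exc σ , fix σ , cyc σ , fcyc σ

module _ {w : List ℕ} (w-perm : IsPermutation w) (1≤len : 1 ≤ length w) where

  cycleStatistics-Φ : cycleStatistics (Φ w) ≡ blockStatistics w
  cycleStatistics-Φ rewrite exc-Φ w-perm | fix-Φ w-perm | cyc-Φ w-perm
                          | fcyc-Φ w-perm 1≤len | fbk≡posMax w-perm 1≤len = refl

∈-perms⇒IsPermutation : ∀ n {w} → w ∈ perms n → IsPermutation w
∈-perms⇒IsPermutation n w∈ =
  let range↭w = ∈-perms⁻ n w∈ in subst (λ m → range m ↭ _) (trans (sym (length-range n)) (↭-length range↭w)) range↭w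

length-∈-perms : ∀ n {w} → w ∈ perms n → length w ≡ n
length-∈-perms n w∈ = trans (sym (↭-length (∈-perms⁻ n w∈))) (length-range n)

map-Φ-perms : ∀ n → map Φ (perms n) ↭ perms n
map-Φ-perms n = unique∧⊆∧length⇒↭
  (unique-map-injectiveOn Φ (λ w∈ v∈ → Φ-injective (∈-perms⇒IsPermutation n w∈) (∈-perms⇒IsPermutation n v∈))
    (unique-perms n))
  (λ τ∈ → let (σ , σ∈ , τ≡) = ∈-map⁻ Φ τ∈ in subst (_∈ perms n) (sym τ≡) (Φ-∈-perms σ∈))
  (≤-reflexive (sym (length-map Φ (perms n))))
  where
  Φ-∈-perms : ∀ {w} → w ∈ perms n → Φ w ∈ perms n
  Φ-∈-perms {w} w∈ = ∈-perms⁺ n (subst (λ m → range m ↭ Φ w) (length-∈-perms n w∈)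
    (Φ-permutation (∈-perms⇒IsPermutation n w∈)))

proposition3p1 : {c ℓ : Level} (R : CommutativeSemiring c ℓ) (x y q p : CommutativeSemiring.Carrier R) (n : ℕ) →
    1 ≤ n → CommutativeSemiring._≈_ R (lhsQ R x y q p n) (rhsQhat R x y q p n)
proposition3p1 R x y q p n 1≤n = begin
  lhsQ R x y q p n
    ≈⟨ sumOver-filter R (isQ n) (perms n) (weight ∘ blockStatistics) ⟩
  sumOver R (perms n) (λ σ → if isQ n σ then weight (blockStatistics σ) else 0#)
    ≈⟨ sumOver-cong-∈ R (perms n) (reflexive ∘ summand-Φ) ⟩
  sumOver R (perms n) (qhatSummand ∘ Φ)
    ≡⟨ sumOver-map R Φ (perms n) qhatSummand ⟨
  sumOver R (map Φ (perms n)) qhatSummand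
    ≈⟨ sumOver-↭ R (map-Φ-perms n) qhatSummand ⟩
  sumOver R (perms n) qhatSummand
    ≈⟨ sumOver-filter R (isQhat n) (perms n) (weight ∘ cycleStatistics) ⟨
  rhsQhat R x y q p n ∎
  where
  open CommutativeSemiring R using (Carrier; _*_; 0#; setoid; reflexive)
  open import Relation.Binary.Reasoning.Setoid setoid
  weight : Statistics → Carrier
  weight (a , b , c , d) = pow R x a * pow R y b * pow R q c * pow R p d
  qhatSummand : List ℕ → Carrier
  qhatSummand τ = if isQhat n τ then weight (cycleStatistics τ) else 0#
  summand-Φ : ∀ {σ} → σ ∈ perms n → (if isQ n σ then weight (blockStatistics σ) else 0#) ≡ qhatSummand (Φ σ)
  summand-Φ {σ} σ∈ with refl ← length-∈-perms n σ∈ = let σ-perm = ∈-perms⇒IsPermutation (length σ) σ∈ in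
    cong₂ (λ b s → if b then weight s else 0#) (isQ≡isQhat-Φ σ-perm 1≤n) (sym (cycleStatistics-Φ σ-perm 1≤n))
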